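{- Let $\mathcal{T}$ be a set of binary phylogenetic $X$-trees, let $S\circ\langle (x,y)\rangle$ be a partial tree-child cherry picking sequence all of whose pairs are essential, and let $R\subseteq X\times X$. Let $R'=\{(x',y')\in R : x'\ne y \text{ and } c_{x',y'}(\mathcal{T}/(S\circ\langle (x,y)\rangle))=c_{x',y'}(\mathcal{T}/S)\}$. Then for every $(x',y')\in R'$, the sequence $S\circ\langle (x,y),(x',y')\rangle$ is dominated by $S\circ\langle (x',y')\rangle$.
   Context: A binary phylogenetic $X'$-tree is a rooted tree whose root has out-degree 2, whose internal non-root nodes have in-degree 1 and out-degree 2, and whose leaves are bijectively labelled by $X'$ (or a single node if $|X'|=1$). A pair $\{x,y\}$ is a cherry of a tree if leaves $x,y$ are siblings. A partial cherry picking sequence is a sequence $\langle (x_1,y_1),\dots,(x_r,y_r)\rangle$ of pairs of elements of $X$; it is tree-child if $y_j\ne x_i$ for all $1\le i<j\le r$. $S_{i,j}$ denotes the subsequence of the $i$th through $j$th elements (empty if $j<i$); $\circ$ denotes concatenation. Applying a sequence to a tree $T$: successively, for each pair $(a,b)$, if $\{a,b\}$ is a cherry of the current tree, delete leaf $a$ and suppress the parent of $b$, otherwise do nothing; $T/S$ is the result, $\mathcal{T}/S=\{T/S:T\in\mathcal{T}\}$. The pair $(x_j,y_j)$ of a partial sequence $P$ is essential if $\mathcal{T}/P_{1,j}\ne\mathcal{T}/P_{1,j-1}$. $c_{x,y}(\mathcal{T}/S)$ is the number of trees in $\mathcal{T}/S$ having $\{x,y\}$ as a cherry. For a tree-child sequence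 $S$, an extension $S\circ S'$ of $S$ is dominated by $S\circ\langle (a,b)\rangle$ if there is an index $j>1$ such that: $(a,b)$ is the $j$th element of $S'$; $c_{a,b}(\mathcal{T}/S)=c_{a,b}(\mathcal{T}/(S\circ S'_{1,j-1}))$; and every pair $(x',y')$ in $S'_{1,j-1}$ satisfies $y'\ne a$ and $\{x',y'\}\ne\{a,b\}$. -}

module Defs where

open import Data.Bool using (Bool; true; false; _∧_; _∨_; if_then_else_)
open import Data.Nat using (ℕ; zero; suc; _<_; _≤_)
open import Data.Product using (_×_; _,_; Σ; ∃; proj₁; proj₂)
open import Data.Sum using (_⊎_)
open import Data.List using (List; []; _∷_; _++_; map; filter; length; take; drop)
open import Data.Bool.ListAction using (any)
open import Data.List.Membership.Propositional using (_∈_)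
open import Data.List.Relation.Unary.All using (All)
open import Data.List.Relation.Unary.Unique.Propositional using (Unique)
open import Relation.Nullary using (¬_; does)
open import Relation.Binary.PropositionalEquality using (_≡_; _≢_)
open import Relation.Binary.Definitions using (DecidableEquality)

-- Rooted binary trees with labelled leaves (children unordered up to `iso`).
data Tree (X : Set) : Set where
  leaf : X → Tree X
  node : Tree X → Tree X → Tree X

leaves : {X : Set} → Tree X → List X
leaves (leaf x)   = x ∷ []
leaves (node l r) = leaves l ++ leaves r

IsPhyloXTree : {X : Set} → Tree X → Set
IsPhyloXTree {X} t = Unique (leaves t) × (∀ (x : X) → x ∈ leaves t)

Seq : Set → Set
Seq X = List (X × X)

TreeChild : {X : Set} → Seq X → Set
TreeChild []             = Data.Unit.⊤
  where import Data.Unit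
TreeChild ((x , y) ∷ S) = All (λ p → proj₂ p ≢ x) S × TreeChild S

module _ {X : Set} (_≟_ : DecidableEquality X) where

  eqb : X → X → Bool
  eqb a b = does (a ≟ b)

  isLeaf : X → Tree X → Bool
  isLeaf a (leaf z)   = eqb a z
  isLeaf a (node _ _) = false

  cherryAt : X → X → Tree X → Tree X → Bool
  cherryAt a b l r = (isLeaf a l ∧ isLeaf b r) ∨ (isLeaf b l ∧ isLeaf a r)

  hasCherry : X → X → Tree X → Bool
  hasCherry a b (leaf _)   = false
  hasCherry a b (node l r) = cherryAt a b l r ∨ hasCherry a b l ∨ hasCherry a b r

  -- picking (a,b): if {a,b} is a cherry, delete a and suppress the parent of b
  -- (the cherry node becomes the leaf b); otherwise do nothing
  pick : X → X → Tree X → Tree X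
  pick a b (leaf z)   = leaf z
  pick a b (node l r) = if cherryAt a b l r then leaf b else node (pick a b l) (pick a b r)

  applySeq : Seq X → Tree X → Tree X
  applySeq []              t = t
  applySeq ((a , b) ∷ S) t = applySeq S (pick a b t)

  -- 𝒯 / S  (a set of trees, represented by a list)
  _/ₛ_ : List (Tree X) → Seq X → List (Tree X)
  𝒯 /ₛ S = map (applySeq S) 𝒯

  iso : Tree X → Tree X → Bool
  iso (leaf a)   (leaf b)     = eqb a b
  iso (leaf _)   (node _ _)   = false
  iso (node _ _) (leaf _)     = false
  iso (node l r) (node l' r') = (iso l l' ∧ iso r r') ∨ (iso l r' ∧ iso r l')

  SetEq : List (Tree X) → List (Tree X) → Set
  SetEq A B = (∀ t → t ∈ A → ∃ λ u → u ∈ B × iso t u ≡ true)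
            × (∀ u → u ∈ B → ∃ λ t → t ∈ A × iso u t ≡ true)

  countDistinct : List (Tree X) → ℕ
  countDistinct []       = 0
  countDistinct (t ∷ ts) = if any (iso t) ts then countDistinct ts else suc (countDistinct ts)

  cnt : X → X → List (Tree X) → ℕ
  cnt a b 𝒯 = countDistinct (Data.List.filter (λ t → Data.Bool.T? (hasCherry a b t)) 𝒯)
    where import Data.Bool

  AllEssential : List (Tree X) → Seq X → Set
  AllEssential 𝒯 P = ∀ k → k < length P → ¬ SetEq (𝒯 /ₛ take (suc k) P) (𝒯 /ₛ take k P)

  -- S ∘ S' is dominated by S ∘ ⟨(a,b)⟩ : there is j > 1 (here i = j - 1 ≥ 1, 0-based
  -- position of the j-th element) such that (a,b) is the j-th element of S',
  -- c_{a,b}(𝒯/S) = c_{a,b}(𝒯/(S ∘ S'_{1,j-1})), and every (x',y') in S'_{1,j-1}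
  -- has y' ≠ a and {x',y'} ≠ {a,b}.
  Dominated : List (Tree X) → Seq X → Seq X → X → X → Set
  Dominated 𝒯 S S' a b =
    Σ ℕ λ i → 1 ≤ i
      × (∃ λ rest → drop i S' ≡ (a , b) ∷ rest)
      × cnt a b (𝒯 /ₛ S) ≡ cnt a b (𝒯 /ₛ (S ++ take i S'))
      × All (λ p → (proj₂ p ≢ a)
                 × ¬ ((proj₁ p ≡ a × proj₂ p ≡ b) ⊎ (proj₁ p ≡ b × proj₂ p ≡ a)))
            (take i S')

module Submission where

-- Take j = 2, so that S'_{1,j-1} = ⟨(x,y)⟩. The count condition is then the
-- hypothesis, and y ≠ x' is the hypothesis x' ≠ y; it remains to rule out
-- {x,y} = {x',y'}. The reversed pairing would give y = x'. If (x,y) = (x',y'),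
-- then x ≠ y, and picking (x,y) in a tree with distinct leaf labels deletes x,
-- so no tree of 𝒯/(S∘⟨(x,y)⟩) has the cherry {x,y}. The hypothesis then says
-- that no tree of 𝒯/S has it either, so picking (x,y) changes nothing,
-- contradicting the essentiality of (x,y).

open import Defs
open import Data.Bool using (true; false; _∧_; _∨_; T?)
open import Data.Bool.Properties using (∨-conicalˡ; ∨-conicalʳ; ∧-conicalˡ; ∧-conicalʳ)
open import Data.Bool.ListAction using (any)
open import Data.Empty using (⊥-elim)
open import Data.List using (List; []; _∷_; _++_; take; length; filter)
open import Data.List.Membership.Propositional using (_∈_; _∉_)
open import Data.List.Membership.Propositional.Properties using (∈-++⁺ˡ; ∈-++⁺ʳ; ∈-++⁻)
open import Data.List.Properties using (length-++)
open import Data.List.Relation.Binary.Disjoint.Propositional using (Disjoint)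
open import Data.List.Relation.Binary.Subset.Propositional using (_⊆_)
open import Data.List.Relation.Unary.All using (All; []; _∷_)
import Data.List.Relation.Unary.All as All
import Data.List.Relation.Unary.All.Properties as Allₚ
open import Data.List.Relation.Unary.AllPairs using ([]; _∷_)
open import Data.List.Relation.Unary.Any using (here; there)
open import Data.List.Relation.Unary.Unique.Propositional using (Unique)
open import Data.Nat using (suc; s≤s; z≤n; _<_)
open import Data.Nat.Properties using (m<m+n)
open import Data.Product using (_×_; _,_; proj₁; proj₂)
open import Data.Sum using (_⊎_; inj₁; inj₂)
open import Data.Unit using (⊤; tt)
open import Relation.Binary.Definitions using (DecidableEquality)
open import Relation.Binary.PropositionalEquality using (_≡_; _≢_; refl; sym; trans; cong; subst; subst₂)
open import Relation.Nullary using (¬_; yes; no)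

∨-true⁻ : ∀ a {b} → a ∨ b ≡ true → a ≡ true ⊎ b ≡ true
∨-true⁻ true  _ = inj₁ refl
∨-true⁻ false e = inj₂ e

take-length-++ : {A : Set} (xs ys : List A) → take (length xs) (xs ++ ys) ≡ xs
take-length-++ []       ys = refl
take-length-++ (x ∷ xs) ys = cong (x ∷_) (take-length-++ xs ys)

take-suc-length-∷ʳ : {A : Set} (xs : List A) (y : A) →
  take (suc (length xs)) (xs ++ y ∷ []) ≡ xs ++ y ∷ []
take-suc-length-∷ʳ []       y = refl
take-suc-length-∷ʳ (x ∷ xs) y = cong (x ∷_) (take-suc-length-∷ʳ xs y)

Unique-++⁻ : {A : Set} (xs ys : List A) →
  Unique (xs ++ ys) → Unique xs × Unique ys × Disjoint xs ys
Unique-++⁻ []       ys u         = [] , u , λ ()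
Unique-++⁻ (x ∷ xs) ys (x∉ ∷ u) with Unique-++⁻ xs ys u | Allₚ.++⁻ xs x∉
... | xs! , ys! , xs#ys | x∉xs , x∉ys = x∉xs ∷ xs! , ys! , disjoint
  where
  disjoint : Disjoint (x ∷ xs) ys
  disjoint (here refl , v∈ys) = Allₚ.All¬⇒¬Any x∉ys v∈ys
  disjoint (there v∈xs , v∈ys) = xs#ys (v∈xs , v∈ys)

DistinctLeaves : {X : Set} → Tree X → Set
DistinctLeaves (leaf _)   = ⊤
DistinctLeaves (node l r) = DistinctLeaves l × DistinctLeaves r × Disjoint (leaves l) (leaves r)

Unique⇒DistinctLeaves : {X : Set} (t : Tree X) → Unique (leaves t) → DistinctLeaves t
Unique⇒DistinctLeaves (leaf _)   _ = tt
Unique⇒DistinctLeaves (node l r) u with Unique-++⁻ (leaves l) (leaves r) u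
... | l! , r! , l#r = Unique⇒DistinctLeaves l l! , Unique⇒DistinctLeaves r r! , l#r

module _ {X : Set} (_≟_ : DecidableEquality X) where

  isLeaf-true : ∀ {a} t → isLeaf _≟_ a t ≡ true → t ≡ leaf a
  isLeaf-true {a} (leaf z) e with a ≟ z
  ... | yes refl = refl
  isLeaf-true (leaf z) () | no _

  cherryAt-true : ∀ {a b} l r → cherryAt _≟_ a b l r ≡ true →
    (l ≡ leaf a × r ≡ leaf b) ⊎ (l ≡ leaf b × r ≡ leaf a)
  cherryAt-true {a} {b} l r e with ∨-true⁻ (isLeaf _≟_ a l ∧ isLeaf _≟_ b r) e
  ... | inj₁ e′ = inj₁ (isLeaf-true l (∧-conicalˡ _ _ e′) , isLeaf-true r (∧-conicalʳ _ _ e′))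
  ... | inj₂ e′ = inj₂ (isLeaf-true l (∧-conicalˡ _ _ e′) , isLeaf-true r (∧-conicalʳ _ _ e′))

  cherryAt⇒∈ : ∀ {a b} l r → cherryAt _≟_ a b l r ≡ true →
    a ∈ leaves (node l r) × b ∈ leaves (node l r)
  cherryAt⇒∈ l r e with cherryAt-true l r e
  ... | inj₁ (refl , refl) = here refl , there (here refl)
  ... | inj₂ (refl , refl) = there (here refl) , here refl

  hasCherry⇒∈ : ∀ {a b} t → hasCherry _≟_ a b t ≡ true → a ∈ leaves t
  hasCherry⇒∈ {a} {b} (node l r) e with ∨-true⁻ (cherryAt _≟_ a b l r) e
  ... | inj₁ e′ = proj₁ (cherryAt⇒∈ l r e′)
  ... | inj₂ e′ with ∨-true⁻ (hasCherry _≟_ a b l) e′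
  ...   | inj₁ eˡ = ∈-++⁺ˡ (hasCherry⇒∈ l eˡ)
  ...   | inj₂ eʳ = ∈-++⁺ʳ (leaves l) (hasCherry⇒∈ r eʳ)

  pick-noCherry : ∀ {a b} t → hasCherry _≟_ a b t ≡ false → pick _≟_ a b t ≡ t
  pick-noCherry (leaf _) _ = refl
  pick-noCherry {a} {b} (node l r) e
    rewrite ∨-conicalˡ (cherryAt _≟_ a b l r) _ e
          | pick-noCherry l (∨-conicalˡ _ _ (∨-conicalʳ (cherryAt _≟_ a b l r) _ e))
          | pick-noCherry r (∨-conicalʳ _ _ (∨-conicalʳ (cherryAt _≟_ a b l r) _ e))
          = refl

  leaves-pick-⊆ : ∀ {a b} t → leaves (pick _≟_ a b t) ⊆ leaves t
  leaves-pick-⊆ (leaf _) v∈ = v∈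
  leaves-pick-⊆ {a} {b} (node l r) v∈ with cherryAt _≟_ a b l r in e
  ... | true with v∈
  ...   | here refl = proj₂ (cherryAt⇒∈ l r e)
  leaves-pick-⊆ {a} {b} (node l r) v∈ | false with ∈-++⁻ (leaves (pick _≟_ a b l)) v∈
  ...   | inj₁ v∈l = ∈-++⁺ˡ (leaves-pick-⊆ l v∈l)
  ...   | inj₂ v∈r = ∈-++⁺ʳ (leaves l) (leaves-pick-⊆ r v∈r)

  pick-DistinctLeaves : ∀ {a b} t → DistinctLeaves t → DistinctLeaves (pick _≟_ a b t)
  pick-DistinctLeaves (leaf _) d = d
  pick-DistinctLeaves {a} {b} (node l r) (dˡ , dʳ , l#r) with cherryAt _≟_ a b l r
  ... | true  = tt
  ... | false = pick-DistinctLeaves l dˡ , pick-DistinctLeaves r dʳ ,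
                λ (v∈l , v∈r) → l#r (leaves-pick-⊆ l v∈l , leaves-pick-⊆ r v∈r)

  -- The node carrying the cherry becomes the leaf y; x occurs nowhere else
  -- because the labels are distinct.
  pick-removes : ∀ {x y} t → DistinctLeaves t → x ≢ y →
    hasCherry _≟_ x y t ≡ true → x ∉ leaves (pick _≟_ x y t)
  pick-removes {x} {y} (node l r) (dˡ , dʳ , l#r) x≢y e x∈ with cherryAt _≟_ x y l r
  ... | true with x∈
  ...   | here x≡y = x≢y x≡y
  pick-removes {x} {y} (node l r) (dˡ , dʳ , l#r) x≢y e x∈ | false
    with ∨-true⁻ (hasCherry _≟_ x y l) e | ∈-++⁻ (leaves (pick _≟_ x y l)) x∈
  ... | inj₁ eˡ | inj₁ x∈l = pick-removes l dˡ x≢y eˡ x∈l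
  ... | inj₁ eˡ | inj₂ x∈r = l#r (hasCherry⇒∈ l eˡ , leaves-pick-⊆ r x∈r)
  ... | inj₂ eʳ | inj₁ x∈l = l#r (leaves-pick-⊆ l x∈l , hasCherry⇒∈ r eʳ)
  ... | inj₂ eʳ | inj₂ x∈r = pick-removes r dʳ x≢y eʳ x∈r

  pick-destroys-cherry : ∀ {x y} t → DistinctLeaves t → x ≢ y →
    hasCherry _≟_ x y (pick _≟_ x y t) ≡ false
  pick-destroys-cherry {x} {y} t d x≢y with hasCherry _≟_ x y t in e
  ... | false rewrite pick-noCherry t e = e
  ... | true with hasCherry _≟_ x y (pick _≟_ x y t) in e′
  ...   | false = refl
  ...   | true  = ⊥-elim (pick-removes t d x≢y e (hasCherry⇒∈ (pick _≟_ x y t) e′))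

  applySeq-DistinctLeaves : ∀ S t → DistinctLeaves t → DistinctLeaves (applySeq _≟_ S t)
  applySeq-DistinctLeaves []            t d = d
  applySeq-DistinctLeaves ((a , b) ∷ S) t d =
    applySeq-DistinctLeaves S (pick _≟_ a b t) (pick-DistinctLeaves t d)

  applySeq-∷ʳ : ∀ S a b t → applySeq _≟_ (S ++ (a , b) ∷ []) t ≡ pick _≟_ a b (applySeq _≟_ S t)
  applySeq-∷ʳ []            a b t = refl
  applySeq-∷ʳ ((c , d) ∷ S) a b t = applySeq-∷ʳ S a b (pick _≟_ c d t)

  countDistinct-∷≢0 : ∀ t ts → countDistinct _≟_ (t ∷ ts) ≢ 0
  countDistinct-∷≢0 t []       ()
  countDistinct-∷≢0 t (u ∷ ts) e with any (iso _≟_ t) (u ∷ ts)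
  ... | true = countDistinct-∷≢0 u ts e
  countDistinct-∷≢0 t (u ∷ ts) () | false

  All-noCherry⇒cnt≡0 : ∀ {a b} ts → All (λ t → hasCherry _≟_ a b t ≡ false) ts → cnt _≟_ a b ts ≡ 0
  All-noCherry⇒cnt≡0 []       []       = refl
  All-noCherry⇒cnt≡0 {a} {b} (t ∷ ts) (e ∷ es) rewrite e = All-noCherry⇒cnt≡0 ts es

  cnt≡0⇒All-noCherry : ∀ {a b} ts → cnt _≟_ a b ts ≡ 0 → All (λ t → hasCherry _≟_ a b t ≡ false) ts
  cnt≡0⇒All-noCherry []       _ = []
  cnt≡0⇒All-noCherry {a} {b} (t ∷ ts) c≡0 with hasCherry _≟_ a b t in e
  ... | false = e ∷ cnt≡0⇒All-noCherry ts c≡0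
  ... | true  = ⊥-elim (countDistinct-∷≢0 t (filter (λ u → T? (hasCherry _≟_ a b u)) ts) c≡0)

  iso-refl : ∀ t → iso _≟_ t t ≡ true
  iso-refl (leaf a) with a ≟ a
  ... | yes _   = refl
  ... | no a≢a = ⊥-elim (a≢a refl)
  iso-refl (node l r) rewrite iso-refl l | iso-refl r = refl

  SetEq-refl : ∀ 𝒯 → SetEq _≟_ 𝒯 𝒯
  SetEq-refl 𝒯 = (λ t t∈ → t , t∈ , iso-refl t) , (λ t t∈ → t , t∈ , iso-refl t)

  pick-noCherry-/ₛ : ∀ {x y} 𝒯 S → All (λ t → hasCherry _≟_ x y t ≡ false) (_/ₛ_ _≟_ 𝒯 S) →
    _/ₛ_ _≟_ 𝒯 (S ++ (x , y) ∷ []) ≡ _/ₛ_ _≟_ 𝒯 S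
  pick-noCherry-/ₛ []      S []       = refl
  pick-noCherry-/ₛ {x} {y} (t ∷ 𝒯) S (e ∷ es)
    rewrite applySeq-∷ʳ S x y t | pick-noCherry (applySeq _≟_ S t) e
    = cong (applySeq _≟_ S t ∷_) (pick-noCherry-/ₛ 𝒯 S es)

  cnt-pick-/ₛ≡0 : ∀ {x y} 𝒯 S → All IsPhyloXTree 𝒯 → x ≢ y →
    cnt _≟_ x y (_/ₛ_ _≟_ 𝒯 (S ++ (x , y) ∷ [])) ≡ 0
  cnt-pick-/ₛ≡0 {x} {y} 𝒯 S phylo x≢y =
    All-noCherry⇒cnt≡0 _ (Allₚ.map⁺ (All.map noCherry phylo))
    where
    noCherry : ∀ {t} → IsPhyloXTree t → hasCherry _≟_ x y (applySeq _≟_ (S ++ (x , y) ∷ []) t) ≡ false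
    noCherry {t} (t! , _) rewrite applySeq-∷ʳ S x y t =
      pick-destroys-cherry _ (applySeq-DistinctLeaves S t (Unique⇒DistinctLeaves t t!)) x≢y

  essential-last : ∀ 𝒯 S p → AllEssential _≟_ 𝒯 (S ++ p ∷ []) →
    ¬ SetEq _≟_ (_/ₛ_ _≟_ 𝒯 (S ++ p ∷ [])) (_/ₛ_ _≟_ 𝒯 S)
  essential-last 𝒯 S p essential =
    subst₂ (λ P Q → ¬ SetEq _≟_ (_/ₛ_ _≟_ 𝒯 P) (_/ₛ_ _≟_ 𝒯 Q))
           (take-suc-length-∷ʳ S p) (take-length-++ S (p ∷ []))
           (essential (length S) last-index)
    where
    last-index : length S < length (S ++ p ∷ [])
    last-index = subst (length S <_) (sym (length-++ S)) (m<m+n (length S) (s≤s z≤n))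

  essential-pick-changes-cnt : ∀ {x y} 𝒯 S → All IsPhyloXTree 𝒯 → x ≢ y →
    AllEssential _≟_ 𝒯 (S ++ (x , y) ∷ []) →
    cnt _≟_ x y (_/ₛ_ _≟_ 𝒯 (S ++ (x , y) ∷ [])) ≢ cnt _≟_ x y (_/ₛ_ _≟_ 𝒯 S)
  essential-pick-changes-cnt {x} {y} 𝒯 S phylo x≢y essential same =
    essential-last 𝒯 S (x , y) essential (subst (λ 𝒰 → SetEq _≟_ 𝒰 _) (sym pick-is-noop) (SetEq-refl _))
    where
    pick-is-noop : _/ₛ_ _≟_ 𝒯 (S ++ (x , y) ∷ []) ≡ _/ₛ_ _≟_ 𝒯 S
    pick-is-noop = pick-noCherry-/ₛ 𝒯 S
      (cnt≡0⇒All-noCherry _ (trans (sym same) (cnt-pick-/ₛ≡0 𝒯 S phylo x≢y)))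

lemma23 : {X : Set} (_≟_ : DecidableEquality X)
    (𝒯 : List (Tree X)) → All IsPhyloXTree 𝒯 →
    (S : Seq X) (x y : X) →
    TreeChild (S ++ (x , y) ∷ []) →
    AllEssential _≟_ 𝒯 (S ++ (x , y) ∷ []) →
    (R : X → X → Set) →
    ∀ x' y' → R x' y' → x' ≢ y →
    cnt _≟_ x' y' (_/ₛ_ _≟_ 𝒯 (S ++ (x , y) ∷ [])) ≡ cnt _≟_ x' y' (_/ₛ_ _≟_ 𝒯 S) →
    Dominated _≟_ 𝒯 S ((x , y) ∷ (x' , y') ∷ []) x' y'
lemma23 _≟_ 𝒯 phylo S x y _ essential _ x' y' _ x'≢y same =
  1 , s≤s z≤n , ([] , refl) , sym same , (y≢x' , ¬same-cherry) ∷ []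
  where
  y≢x' : y ≢ x'
  y≢x' y≡x' = x'≢y (sym y≡x')

  ¬same-cherry : ¬ ((x ≡ x' × y ≡ y') ⊎ (x ≡ y' × y ≡ x'))
  ¬same-cherry (inj₁ (refl , refl)) = essential-pick-changes-cnt _≟_ 𝒯 S phylo x'≢y essential same
  ¬same-cherry (inj₂ (_ , y≡x'))    = y≢x' y≡x'
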